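{- For all $k\ge 1$ and all $n\ge j\ge 1$, $$N(n,j,k)=\sum_{i=0}^{n-j}N(n-j,i,k-1)\binom{2n-j-i}{2n-2j},$$ equivalently $$N(n,j,k)=\sum_{i=0}^{n-j}N(n-j,n-j-i,k-1)\binom{n+i}{2n-2j}.$$
   Context: An ordered tree is a rooted tree in which the children of each vertex are linearly ordered; its height is the maximum distance from a vertex to the root, and a leaf is a vertex with no children. For integers $n,j,k\ge 0$, $N(n,j,k)$ denotes the number of ordered trees with $n$ edges, $j$ leaves, and height at most $k$, with the convention that the one-vertex tree (no edges) is counted in $N(0,0,k)$ and has zero leaves for this purpose, so $N(0,0,k)=1$ for all $k\ge 0$. -}

module Defs where

open import Data.Nat using (ℕ; zero; suc; _+_; _⊔_; _≤_)
open import Data.List using (List; []; _∷_; map; upTo)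
open import Data.Nat.ListAction using (sum)
open import Data.Product using (Σ; _×_)
open import Data.Fin using (Fin)
open import Function.Bundles using (_↔_)
open import Relation.Binary.PropositionalEquality using (_≡_)

data Tree : Set where
  node : List Tree → Tree

mutual
  edges : Tree → ℕ
  edges (node cs) = edgesL cs

  edgesL : List Tree → ℕ
  edgesL []       = 0
  edgesL (c ∷ cs) = suc (edges c) + edgesL cs

mutual
  height : Tree → ℕ
  height (node []) = 0
  height (node (c ∷ cs)) = suc (heightL (c ∷ cs))

  heightL : List Tree → ℕ
  heightL []       = 0
  heightL (c ∷ cs) = height c ⊔ heightL cs

mutual
  leafCount : Tree → ℕ
  leafCount (node []) = 1
  leafCount (node (c ∷ cs)) = leafCountL (c ∷ cs)

  leafCountL : List Tree → ℕ
  leafCountL []       = 0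
  leafCountL (c ∷ cs) = leafCount c + leafCountL cs

-- leaves of a tree, with the paper's convention that the one-vertex tree
-- has zero leaves
leaves : Tree → ℕ
leaves (node []) = 0
leaves (node (c ∷ cs)) = leafCountL (c ∷ cs)

Trees : ℕ → ℕ → ℕ → Set
Trees n j k = Σ Tree (λ t → (edges t ≡ n) × ((leaves t ≡ j) × (height t ≤ k)))

HasCard : Set → ℕ → Set
HasCard A m = Fin m ↔ A

sumTo : ℕ → (ℕ → ℕ) → ℕ
sumTo m f = sum (map f (upTo (suc m)))

module Submission where

open import Defs
open import Data.Nat using (ℕ; _+_; _∸_; _*_; _≤_)
open import Data.Nat.Combinatorics using (_C_)
open import Data.Product using (_×_)
open import Relation.Binary.PropositionalEquality using (_≡_)

open import Data.Nat using (zero; suc; _<_; _⊔_; z≤n; s≤s; s≤s⁻¹; _≤?_)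
open import Data.Nat.Properties
open import Data.Nat.Combinatorics using (nCn≡1; nCk+nC[k+1]≡[n+1]C[k+1]; k>n⇒nCk≡0)
open import Data.Nat.ListAction using (sum)
open import Data.Nat.Tactic.RingSolver using (solve-∀)
open import Data.Unit using (⊤; tt)
open import Data.Empty using (⊥-elim)
open import Data.List using (List; []; _∷_; _++_; replicate; applyUpTo)
open import Data.List.Properties using (map-applyUpTo)
open import Data.Vec using (Vec; []; _∷_; splitAt) renaming (_++_ to _++ᵥ_; sum to sumᵥ)
open import Data.Vec.Properties using (sum-++; ++-injective)
open import Data.Fin using (Fin; toℕ; fromℕ<; opposite)
import Data.Fin as Fin
open import Data.Fin.Properties using (+↔⊎; *↔×; toℕ-fromℕ<; toℕ-injective; toℕ≤pred[n]; opposite-prop; opposite-involutive)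
open import Data.Fin.Permutation using (↔⇒≡)
open import Data.Product using (Σ; _,_; proj₁; proj₂; uncurry)
open import Data.Product.Function.NonDependent.Propositional using (_×-↔_)
open import Data.Product.Function.Dependent.Propositional using (Σ-↔)
open import Data.Sum using (_⊎_; inj₁; inj₂)
open import Data.Sum.Function.Propositional using (_⊎-↔_)
open import Function using (id; _∘_)
open import Function.Bundles using (_↔_; mk↔ₛ′; Inverse)
open import Function.Properties.Inverse using (↔-refl; ↔-sym; ↔-trans)
open import Function.Related.Propositional using (module EquationalReasoning; bijection)
open import Relation.Nullary using (¬_; Irrelevant; yes; no)
open import Relation.Binary.PropositionalEquality using (refl; sym; trans; cong; cong₂; subst; module ≡-Reasoning)

-- The recurrence is proved bijectively.  Let j ≥ 1.  A tree T with n edges,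
-- j leaves and height at most k = h + 1 has a nonempty root; deleting all its
-- leaves gives a tree t with e = n - j edges and height at most h, and T is
-- recovered from t by recording, at each of the 2e + 1 "gaps" of t (the
-- positions before, between and after the children of each vertex), how many
-- leaves are inserted there -- every leaf of t must receive at least one.
-- Hence, when t has i leaves, the trees T over t correspond to the weak
-- compositions of j - i into 2e + 1 parts, of which there are
-- C(2e + j - i, 2e) = C(2n - j - i, 2n - 2j) by stars and bars.

private
  variable
    A B D : Set
    m n : ℕ

module ↔-Reasoning = EquationalReasoning {k = bijection}

Fin-cong : m ≡ n → Fin m ↔ Fin n
Fin-cong refl = ↔-refl

Fin1↔ : (x : A) → (∀ y → y ≡ x) → Fin 1 ↔ A
Fin1↔ x unique = mk↔ₛ′ (λ _ → x) (λ _ → Fin.zero) (λ y → sym (unique y)) λ { Fin.zero → refl ; (Fin.suc ()) }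

Fin0↔ : ¬ A → Fin 0 ↔ A
Fin0↔ empty = mk↔ₛ′ (λ ()) (⊥-elim ∘ empty) (⊥-elim ∘ empty) (λ ())

irrelevant-↔ : Irrelevant A → Irrelevant B → (A → B) → (B → A) → A ↔ B
irrelevant-↔ irrA irrB f g = mk↔ₛ′ f g (λ _ → irrB _ _) (λ _ → irrA _ _)

Σ-Fin-suc : ∀ {k} {P : Fin (suc k) → Set} → (P Fin.zero ⊎ Σ (Fin k) (P ∘ Fin.suc)) ↔ Σ (Fin (suc k)) P
Σ-Fin-suc = mk↔ₛ′ (λ { (inj₁ p) → Fin.zero , p ; (inj₂ (i , p)) → Fin.suc i , p })
                  (λ { (Fin.zero , p) → inj₁ p ; (Fin.suc i , p) → inj₂ (i , p) })
                  (λ { (Fin.zero , p) → refl ; (Fin.suc i , p) → refl })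
                  (λ { (inj₁ p) → refl ; (inj₂ (i , p)) → refl })

partition : ∀ {P : A → Set} (f : A → ℕ) → (∀ a → f a ≤ m) →
  Σ A P ↔ Σ (Fin (suc m)) (λ i → Σ (Σ A (λ a → f a ≡ toℕ i)) (P ∘ proj₁))
partition {A = A} {m = m} {P = P} f bound = mk↔ₛ′ sort forget sort-forget (λ _ → refl)
  where
  Sorted : Set
  Sorted = Σ (Fin (suc m)) (λ i → Σ (Σ A (λ a → f a ≡ toℕ i)) (P ∘ proj₁))
  sort : Σ A P → Sorted
  sort (a , p) = fromℕ< (s≤s (bound a)) , (a , sym (toℕ-fromℕ< _)) , p
  forget : Sorted → Σ A P
  forget (_ , (a , _) , p) = a , p
  same-class : ∀ {a p i i′} → i ≡ i′ → (q : f a ≡ toℕ i) (q′ : f a ≡ toℕ i′) →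
               _≡_ {A = Sorted} (i , (a , q) , p) (i′ , (a , q′) , p)
  same-class refl q q′ = cong (λ r → _ , (_ , r) , _) (≡-irrelevant q q′)
  sort-forget : ∀ x → sort (forget x) ≡ x
  sort-forget (i , (a , q) , p) = same-class (toℕ-injective (trans (toℕ-fromℕ< _) q)) _ q

Composition : ℕ → ℕ → Set
Composition s m = Σ (Vec ℕ s) (λ v → sumᵥ v ≡ m)

Composition-cong : ∀ {s s′ m} → s ≡ s′ → Composition s m ↔ Composition s′ m
Composition-cong refl = ↔-refl

-- A positive composition of m+1 either has first part zero (leaving a
-- composition of m+1 into the remaining parts) or lowering its first part
-- leaves a composition of m.
composition-step : ∀ s m → Composition (suc s) (suc m) ↔ (Composition (suc s) m ⊎ Composition s (suc m))
composition-step s m = mk↔ₛ′ split join split-join join-split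
  where
  split : Composition (suc s) (suc m) → Composition (suc s) m ⊎ Composition s (suc m)
  split (zero ∷ v , e) = inj₂ (v , e)
  split (suc x ∷ v , e) = inj₁ (x ∷ v , suc-injective e)
  join : Composition (suc s) m ⊎ Composition s (suc m) → Composition (suc s) (suc m)
  join (inj₁ (x ∷ v , e)) = suc x ∷ v , cong suc e
  join (inj₂ (v , e)) = zero ∷ v , e
  split-join : ∀ y → split (join y) ≡ y
  split-join (inj₁ (x ∷ v , e)) = cong (λ e′ → inj₁ (x ∷ v , e′)) (≡-irrelevant _ _)
  split-join (inj₂ (v , e)) = refl
  join-split : ∀ c → join (split c) ≡ c
  join-split (zero ∷ v , e) = refl
  join-split (suc x ∷ v , e) = cong (suc x ∷ v ,_) (≡-irrelevant _ _)

composition-single : ∀ m → Fin 1 ↔ Composition 1 m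
composition-single m = Fin1↔ (m ∷ [] , +-identityʳ m) unique
  where
  unique : ∀ c → c ≡ (m ∷ [] , +-identityʳ m)
  unique (x ∷ [] , e) = part-is-m x (trans (sym (+-identityʳ x)) e) e
    where
    part-is-m : ∀ x → x ≡ m → (e : x + 0 ≡ m) → (x ∷ [] , e) ≡ (m ∷ [] , +-identityʳ m)
    part-is-m x refl e = cong (x ∷ [] ,_) (≡-irrelevant _ _)

composition-zero : ∀ s → Fin 1 ↔ Composition s 0
composition-zero s = Fin1↔ (zeros s , sum-zeros s) unique
  where
  zeros : ∀ s → Vec ℕ s
  zeros zero = []
  zeros (suc s) = 0 ∷ zeros s
  sum-zeros : ∀ s → sumᵥ (zeros s) ≡ 0
  sum-zeros zero = refl
  sum-zeros (suc s) = sum-zeros s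
  all-zero : ∀ {s} (v : Vec ℕ s) → sumᵥ v ≡ 0 → v ≡ zeros s
  all-zero [] e = refl
  all-zero (zero ∷ v) e = cong (0 ∷_) (all-zero v e)
  unique : ∀ c → c ≡ (zeros s , sum-zeros s)
  unique (v , e) with all-zero v e
  ... | refl = cong (zeros s ,_) (≡-irrelevant _ _)

-- Pascal's rule in the shape produced by composition-step.
pascal : ∀ p m → (suc m + suc p) C suc p ≡ (m + suc p) C suc p + (suc m + p) C p
pascal p m = begin
  (suc m + suc p) C suc p                ≡⟨ sym (nCk+nC[k+1]≡[n+1]C[k+1] (m + suc p) p) ⟩
  (m + suc p) C p + (m + suc p) C suc p  ≡⟨ +-comm ((m + suc p) C p) _ ⟩
  (m + suc p) C suc p + (m + suc p) C p  ≡⟨ cong (λ x → (m + suc p) C suc p + x C p) (+-suc m p) ⟩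
  (m + suc p) C suc p + (suc m + p) C p  ∎
  where open ≡-Reasoning

compositions : ∀ p m → Fin ((m + p) C p) ↔ Composition (suc p) m
compositions zero m = composition-single m
compositions (suc p) zero = ↔-trans (Fin-cong (nCn≡1 (suc p))) (composition-zero (suc (suc p)))
compositions (suc p) (suc m) = begin
  Fin ((suc m + suc p) C suc p)                             ↔⟨ Fin-cong (pascal p m) ⟩
  Fin ((m + suc p) C suc p + (suc m + p) C p)               ↔⟨ +↔⊎ ⟩
  (Fin ((m + suc p) C suc p) ⊎ Fin ((suc m + p) C p))       ↔⟨ compositions (suc p) m ⊎-↔ compositions p (suc m) ⟩
  (Composition (suc (suc p)) m ⊎ Composition (suc p) (suc m)) ↔⟨ composition-step (suc p) m ⟨
  Composition (suc (suc p)) (suc m)                          ∎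
  where open ↔-Reasoning

∷-↔ : (A × Vec A n) ↔ Vec A (suc n)
∷-↔ = mk↔ₛ′ (uncurry _∷_) (λ { (x ∷ xs) → x , xs }) (λ { (x ∷ xs) → refl }) (λ _ → refl)

++-↔ : (Vec A m × Vec A n) ↔ Vec A (m + n)
++-↔ {A = A} {m = m} {n = n} = mk↔ₛ′ (uncurry _++ᵥ_) split concat-split split-concat
  where
  split : Vec A (m + n) → Vec A m × Vec A n
  split v = let xs , ys , _ = splitAt m v in xs , ys
  concat-split : ∀ v → uncurry _++ᵥ_ (split v) ≡ v
  concat-split v = sym (proj₂ (proj₂ (splitAt m v)))
  split-concat : ∀ p → split (uncurry _++ᵥ_ p) ≡ p
  split-concat (xs , ys) with splitAt m (xs ++ᵥ ys)
  ... | xs′ , ys′ , eq with ++-injective xs xs′ eq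
  ... | refl , refl = refl

Fin-sum : ∀ k (f : ℕ → ℕ) → Fin (sum (applyUpTo f k)) ↔ Σ (Fin k) (λ i → Fin (f (toℕ i)))
Fin-sum zero f = Fin0↔ λ ()
Fin-sum (suc k) f = ↔-trans +↔⊎ (↔-trans (↔-refl ⊎-↔ Fin-sum k (f ∘ suc)) Σ-Fin-suc)

Fin-sumTo : ∀ m f → Fin (sumTo m f) ↔ Σ (Fin (suc m)) (λ i → Fin (f (toℕ i)))
Fin-sumTo m f = ↔-trans (Fin-cong (cong sum (map-applyUpTo id f (suc m)))) (Fin-sum (suc m) f)

sumTo-↔ : ∀ m f g → Σ (Fin (suc m)) (λ i → Fin (f (toℕ i))) ↔ Σ (Fin (suc m)) (λ i → Fin (g (toℕ i))) → sumTo m f ≡ sumTo m g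
sumTo-↔ m f g φ = ↔⇒≡ (↔-trans (Fin-sumTo m f) (↔-trans φ (↔-sym (Fin-sumTo m g))))

sumTo-reverse : ∀ m f → sumTo m f ≡ sumTo m (λ i → f (m ∸ i))
sumTo-reverse m f = sumTo-↔ m f _ (Σ-↔ reverse (Fin-cong (cong f (sym back))))
  where
  reverse : Fin (suc m) ↔ Fin (suc m)
  reverse = mk↔ₛ′ opposite opposite opposite-involutive opposite-involutive
  back : ∀ {i} → m ∸ toℕ (opposite i) ≡ toℕ i
  back {i} = trans (cong (m ∸_) (opposite-prop i)) (m∸[m∸n]≡n (toℕ≤pred[n] i))

sumTo-cong : ∀ m f g → (∀ i → i ≤ m → f i ≡ g i) → sumTo m f ≡ sumTo m g
sumTo-cong m f g eq = sumTo-↔ m f g (Σ-↔ ↔-refl (λ {i} → Fin-cong (eq (toℕ i) (toℕ≤pred[n] i))))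

leaf : Tree
leaf = node []

-- A decoration of a tree t records, for every vertex v of t, how many
-- leaves are to be inserted into each of the (number of children of v) + 1
-- gaps around the children of v.  A vertex of t without children always
-- receives one leaf more than recorded, so that it stays an internal vertex.
mutual
  Decoration : Tree → Set
  Decoration (node cs) = ℕ × Decorations cs

  Decorations : List Tree → Set
  Decorations [] = ⊤
  Decorations (c ∷ cs) = Decoration c × ℕ × Decorations cs

Decorated : Set
Decorated = Σ Tree Decoration

mutual
  total : (t : Tree) → Decoration t → ℕ
  total (node cs) (g , r) = g + totalL cs r

  totalL : (cs : List Tree) → Decorations cs → ℕ
  totalL [] tt = 0
  totalL (c ∷ cs) (d , g , r) = total c d + (g + totalL cs r)

-- Nonempty lists of trees: the children of a vertex that is not a leaf.
Forest⁺ : Set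
Forest⁺ = Tree × List Tree

toList : Forest⁺ → List Tree
toList (a , as) = a ∷ as

plant : Forest⁺ → Tree
plant (a , as) = node (a ∷ as)

-- Grafting the decoration onto t: the children of the root of the grown tree.
mutual
  graft : (t : Tree) → Decoration t → Forest⁺
  graft (node []) (g , tt) = leaf , fill [] (g , tt)
  graft (node (c ∷ cs)) (zero , d , r) = plant (graft c d) , fill cs r
  graft (node (c ∷ cs)) (suc g , r) = leaf , fill (c ∷ cs) (g , r)

  -- the children of a grown vertex whose children in t are cs, when no
  -- extra leaf is forced
  fill : (cs : List Tree) → Decoration (node cs) → List Tree
  fill cs (g , r) = replicate g leaf ++ fillChildren cs r

  fillChildren : (cs : List Tree) → Decorations cs → List Tree
  fillChildren [] tt = []
  fillChildren (c ∷ cs) (d , r) = plant (graft c d) ∷ fill cs r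

addLeaves : ℕ → Decorated → Decorated
addLeaves k (node cs , g , r) = node cs , k + g , r

addChild : Decorated → Decorated → Decorated
addChild (c , d) (node cs , r) = node (c ∷ cs) , 0 , d , r

-- Pruning all leaves of the tree whose root has children a ∷ as, remembering
-- where they were; pruneForest does the same for a list of siblings, without
-- the extra leaf at a childless root.
mutual
  prune : Tree → List Tree → Decorated
  prune (node []) [] = leaf , 0 , tt
  prune (node []) (b ∷ bs) = addLeaves 1 (prune b bs)
  prune (node (x ∷ xs)) as = addChild (prune x xs) (pruneForest as)

  pruneForest : List Tree → Decorated
  pruneForest [] = leaf , 0 , tt
  pruneForest (node [] ∷ as) = addLeaves 1 (pruneForest as)
  pruneForest (node (x ∷ xs) ∷ as) = addChild (prune x xs) (pruneForest as)

fillDecorated : Decorated → List Tree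
fillDecorated (node cs , r) = fill cs r

addLeaves-suc : ∀ k x → addLeaves 1 (addLeaves k x) ≡ addLeaves (suc k) x
addLeaves-suc k (node cs , g , r) = refl

addLeaves-zero : ∀ x → addLeaves 0 x ≡ x
addLeaves-zero (node cs , g , r) = refl

addLeaves-start : ∀ k cs (r : Decorations cs) → addLeaves k (node cs , 0 , r) ≡ (node cs , k , r)
addLeaves-start k cs r = cong (λ g → node cs , g , r) (+-identityʳ k)

prune-leaves : ∀ g → prune leaf (fill [] (g , tt)) ≡ (leaf , g , tt)
prune-leaves zero = refl
prune-leaves (suc g) = cong (addLeaves 1) (prune-leaves g)

prune-leading-leaves : ∀ g b bs → prune leaf (replicate g leaf ++ b ∷ bs) ≡ addLeaves (suc g) (prune b bs)
prune-leading-leaves zero b bs = refl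
prune-leading-leaves (suc g) b bs =
  trans (cong (addLeaves 1) (prune-leading-leaves g b bs)) (addLeaves-suc (suc g) (prune b bs))

pruneForest-leading-leaves : ∀ g as → pruneForest (replicate g leaf ++ as) ≡ addLeaves g (pruneForest as)
pruneForest-leading-leaves zero as = sym (addLeaves-zero (pruneForest as))
pruneForest-leading-leaves (suc g) as =
  trans (cong (addLeaves 1) (pruneForest-leading-leaves g as)) (addLeaves-suc g (pruneForest as))

mutual
  prune-graft : ∀ t d → uncurry prune (graft t d) ≡ (t , d)
  prune-graft (node []) (g , tt) = prune-leaves g
  prune-graft (node (c ∷ cs)) (zero , d , r) = cong₂ addChild (prune-graft c d) (pruneForest-fill cs r)
  prune-graft (node (c ∷ cs)) (suc g , d , r) = begin
    prune leaf (replicate g leaf ++ plant (graft c d) ∷ fill cs r)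
      ≡⟨ prune-leading-leaves g (plant (graft c d)) (fill cs r) ⟩
    addLeaves (suc g) (addChild (uncurry prune (graft c d)) (pruneForest (fill cs r)))
      ≡⟨ cong (addLeaves (suc g)) (cong₂ addChild (prune-graft c d) (pruneForest-fill cs r)) ⟩
    addLeaves (suc g) (node (c ∷ cs) , 0 , d , r)
      ≡⟨ addLeaves-start (suc g) (c ∷ cs) (d , r) ⟩
    (node (c ∷ cs) , suc g , d , r) ∎
    where open ≡-Reasoning

  pruneForest-fill : ∀ cs r → pruneForest (fill cs r) ≡ (node cs , r)
  pruneForest-fill cs (g , r) = begin
    pruneForest (replicate g leaf ++ fillChildren cs r) ≡⟨ pruneForest-leading-leaves g _ ⟩
    addLeaves g (pruneForest (fillChildren cs r))      ≡⟨ cong (addLeaves g) (pruneForest-fillChildren cs r) ⟩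
    addLeaves g (node cs , 0 , r)                      ≡⟨ addLeaves-start g cs r ⟩
    (node cs , g , r)                                  ∎
    where open ≡-Reasoning

  pruneForest-fillChildren : ∀ cs r → pruneForest (fillChildren cs r) ≡ (node cs , 0 , r)
  pruneForest-fillChildren [] tt = refl
  pruneForest-fillChildren (c ∷ cs) (d , r) = cong₂ addChild (prune-graft c d) (pruneForest-fill cs r)

graft-addLeaf : ∀ x → uncurry graft (addLeaves 1 x) ≡ (leaf , toList (uncurry graft x))
graft-addLeaf (node [] , g , tt) = refl
graft-addLeaf (node (c ∷ cs) , zero , r) = refl
graft-addLeaf (node (c ∷ cs) , suc g , r) = refl

graft-addChild : ∀ y x → uncurry graft (addChild y x) ≡ (plant (uncurry graft y) , fillDecorated x)
graft-addChild y (node cs , r) = refl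

fill-addLeaf : ∀ x → fillDecorated (addLeaves 1 x) ≡ leaf ∷ fillDecorated x
fill-addLeaf (node cs , g , r) = refl

fill-addChild : ∀ y x → fillDecorated (addChild y x) ≡ plant (uncurry graft y) ∷ fillDecorated x
fill-addChild y (node cs , r) = refl

mutual
  graft-prune : ∀ a as → uncurry graft (prune a as) ≡ (a , as)
  graft-prune (node []) [] = refl
  graft-prune (node []) (b ∷ bs) =
    trans (graft-addLeaf (prune b bs)) (cong (λ f → leaf , toList f) (graft-prune b bs))
  graft-prune (node (x ∷ xs)) as = trans (graft-addChild (prune x xs) (pruneForest as))
    (cong₂ (λ f rest → plant f , rest) (graft-prune x xs) (fill-pruneForest as))

  fill-pruneForest : ∀ as → fillDecorated (pruneForest as) ≡ as
  fill-pruneForest [] = refl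
  fill-pruneForest (node [] ∷ as) = trans (fill-addLeaf (pruneForest as)) (cong (leaf ∷_) (fill-pruneForest as))
  fill-pruneForest (node (x ∷ xs) ∷ as) = trans (fill-addChild (prune x xs) (pruneForest as))
    (cong₂ (λ f rest → plant f ∷ rest) (graft-prune x xs) (fill-pruneForest as))

pruning : Forest⁺ ↔ Decorated
pruning = mk↔ₛ′ (uncurry prune) (uncurry graft) (λ (t , d) → prune-graft t d) (λ (a , as) → graft-prune a as)

edgesL-leaves : ∀ g ys → edgesL (replicate g leaf ++ ys) ≡ g + edgesL ys
edgesL-leaves zero ys = refl
edgesL-leaves (suc g) ys = cong suc (edgesL-leaves g ys)

leafCountL-leaves : ∀ g ys → leafCountL (replicate g leaf ++ ys) ≡ g + leafCountL ys
leafCountL-leaves zero ys = refl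
leafCountL-leaves (suc g) ys = cong suc (leafCountL-leaves g ys)

heightL-leaves : ∀ g ys → heightL (replicate g leaf ++ ys) ≡ heightL ys
heightL-leaves zero ys = refl
heightL-leaves (suc g) ys = heightL-leaves g ys

graft-internal : ∀ c cs d → toList (graft (node (c ∷ cs)) d) ≡ fill (c ∷ cs) d
graft-internal c cs (zero , r) = refl
graft-internal c cs (suc g , r) = refl

height-cons : ∀ c cs → height (node (c ∷ cs)) ≡ suc (height c) ⊔ height (node cs)
height-cons c [] = cong suc (⊔-identityʳ (height c))
height-cons c (c′ ∷ cs) = refl

-- Every leaf of t, and every recorded leaf, adds one edge to the grown tree.
mutual
  edges-graft : ∀ t d → edgesL (toList (graft t d)) ≡ edges t + leafCount t + total t d
  edges-graft (node []) d = cong suc (edges-fill [] d)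
  edges-graft (node (c ∷ cs)) d = trans (cong edgesL (graft-internal c cs d)) (edges-fill (c ∷ cs) d)

  edges-fill : ∀ cs d → edgesL (fill cs d) ≡ edgesL cs + leafCountL cs + total (node cs) d
  edges-fill cs (g , r) = begin
    edgesL (replicate g leaf ++ fillChildren cs r)     ≡⟨ edgesL-leaves g _ ⟩
    g + edgesL (fillChildren cs r)                     ≡⟨ cong (g +_) (edges-fillChildren cs r) ⟩
    g + (edgesL cs + leafCountL cs + totalL cs r)      ≡⟨ regroup g (edgesL cs) (leafCountL cs) (totalL cs r) ⟩
    edgesL cs + leafCountL cs + (g + totalL cs r)      ∎
    where
    open ≡-Reasoning
    regroup : ∀ g e l x → g + (e + l + x) ≡ e + l + (g + x)
    regroup = solve-∀

  edges-fillChildren : ∀ cs r → edgesL (fillChildren cs r) ≡ edgesL cs + leafCountL cs + totalL cs r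
  edges-fillChildren [] tt = refl
  edges-fillChildren (c ∷ cs) (d , r) =
    trans (cong₂ (λ x y → suc x + y) (edges-graft c d) (edges-fill cs r))
          (regroup (edges c) (leafCount c) (total c d) (edgesL cs) (leafCountL cs) (total (node cs) r))
    where
    regroup : ∀ e l x e′ l′ x′ → suc (e + l + x) + (e′ + l′ + x′) ≡ suc e + e′ + (l + l′) + (x + x′)
    regroup = solve-∀

mutual
  leaves-graft : ∀ t d → leafCountL (toList (graft t d)) ≡ leafCount t + total t d
  leaves-graft (node []) d = cong suc (leaves-fill [] d)
  leaves-graft (node (c ∷ cs)) d = trans (cong leafCountL (graft-internal c cs d)) (leaves-fill (c ∷ cs) d)

  leaves-fill : ∀ cs d → leafCountL (fill cs d) ≡ leafCountL cs + total (node cs) d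
  leaves-fill cs (g , r) = begin
    leafCountL (replicate g leaf ++ fillChildren cs r)  ≡⟨ leafCountL-leaves g _ ⟩
    g + leafCountL (fillChildren cs r)                  ≡⟨ cong (g +_) (leaves-fillChildren cs r) ⟩
    g + (leafCountL cs + totalL cs r)                   ≡⟨ regroup g (leafCountL cs) (totalL cs r) ⟩
    leafCountL cs + (g + totalL cs r)                   ∎
    where
    open ≡-Reasoning
    regroup : ∀ g l x → g + (l + x) ≡ l + (g + x)
    regroup = solve-∀

  leaves-fillChildren : ∀ cs r → leafCountL (fillChildren cs r) ≡ leafCountL cs + totalL cs r
  leaves-fillChildren [] tt = refl
  leaves-fillChildren (c ∷ cs) (d , r) =
    trans (cong₂ _+_ (leaves-graft c d) (leaves-fill cs r))
          (regroup (leafCount c) (total c d) (leafCountL cs) (total (node cs) r))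
    where
    regroup : ∀ l x l′ x′ → l + x + (l′ + x′) ≡ l + l′ + (x + x′)
    regroup = solve-∀

mutual
  height-graft : ∀ t d → heightL (toList (graft t d)) ≡ height t
  height-graft (node []) d = height-fill [] d
  height-graft (node (c ∷ cs)) d = trans (cong heightL (graft-internal c cs d)) (height-fill (c ∷ cs) d)

  height-fill : ∀ cs d → heightL (fill cs d) ≡ height (node cs)
  height-fill cs (g , r) = trans (heightL-leaves g _) (height-fillChildren cs r)

  height-fillChildren : ∀ cs r → heightL (fillChildren cs r) ≡ height (node cs)
  height-fillChildren [] tt = refl
  height-fillChildren (c ∷ cs) (d , r) =
    trans (cong₂ (λ x y → suc x ⊔ y) (height-graft c d) (height-fill cs r)) (sym (height-cons c cs))

-- The number of gaps of a tree: one more than the number of children, summed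
-- over all vertices.
mutual
  gaps : Tree → ℕ
  gaps (node cs) = suc (gapsL cs)

  gapsL : List Tree → ℕ
  gapsL [] = 0
  gapsL (c ∷ cs) = gaps c + suc (gapsL cs)

-- A tree with e edges has e + 1 vertices and hence 2e + 1 gaps.
mutual
  gaps-edges : ∀ t → gaps t ≡ suc (edges t + edges t)
  gaps-edges (node cs) = cong suc (gapsL-edgesL cs)

  gapsL-edgesL : ∀ cs → gapsL cs ≡ edgesL cs + edgesL cs
  gapsL-edgesL [] = refl
  gapsL-edgesL (c ∷ cs) = trans (cong₂ (λ x y → x + suc y) (gaps-edges c) (gapsL-edgesL cs)) (rearrange (edges c) (edgesL cs))
    where
    rearrange : ∀ a b → suc (a + a) + suc (b + b) ≡ suc a + b + (suc a + b)
    rearrange = solve-∀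

mutual
  flatten : ∀ t → Decoration t ↔ Vec ℕ (gaps t)
  flatten (node cs) = ↔-trans (↔-refl ×-↔ flattenL cs) ∷-↔

  flattenL : ∀ cs → Decorations cs ↔ Vec ℕ (gapsL cs)
  flattenL [] = mk↔ₛ′ (λ _ → []) (λ _ → tt) (λ { [] → refl }) (λ _ → refl)
  flattenL (c ∷ cs) = ↔-trans (flatten c ×-↔ ↔-trans (↔-refl ×-↔ flattenL cs) ∷-↔) ++-↔

mutual
  sum-flatten : ∀ t d → sumᵥ (Inverse.to (flatten t) d) ≡ total t d
  sum-flatten (node cs) (g , r) = cong (g +_) (sum-flattenL cs r)

  sum-flattenL : ∀ cs r → sumᵥ (Inverse.to (flattenL cs) r) ≡ totalL cs r
  sum-flattenL [] tt = refl
  sum-flattenL (c ∷ cs) (d , g , r) =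
    trans (sum-++ (Inverse.to (flatten c) d)) (cong₂ (λ x y → x + (g + y)) (sum-flatten c d) (sum-flattenL cs r))

decorations-with-total : ∀ t m → Fin ((m + (edges t + edges t)) C (edges t + edges t)) ↔ Σ (Decoration t) (λ d → total t d ≡ m)
decorations-with-total t m = begin
  Fin ((m + (edges t + edges t)) C (edges t + edges t)) ↔⟨ compositions (edges t + edges t) m ⟩
  Composition (suc (edges t + edges t)) m               ↔⟨ Composition-cong (gaps-edges t) ⟨
  Composition (gaps t) m                                ↔⟨ Σ-↔ (flatten t) same-total ⟨
  Σ (Decoration t) (λ d → total t d ≡ m)                ∎
  where
  open ↔-Reasoning
  same-total : ∀ {d} → (total t d ≡ m) ↔ (sumᵥ (Inverse.to (flatten t) d) ≡ m)
  same-total {d} = irrelevant-↔ ≡-irrelevant ≡-irrelevant (trans (sum-flatten t d)) (trans (sym (sum-flatten t d)))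

mutual
  leafCount-≤ : ∀ t → leafCount t ≤ suc (edges t)
  leafCount-≤ (node []) = s≤s z≤n
  leafCount-≤ (node (c ∷ cs)) = m≤n⇒m≤1+n (leafCountL-≤ (c ∷ cs))

  leafCountL-≤ : ∀ cs → leafCountL cs ≤ edgesL cs
  leafCountL-≤ [] = z≤n
  leafCountL-≤ (c ∷ cs) = +-mono-≤ (leafCount-≤ c) (leafCountL-≤ cs)

leaves-≤ : ∀ t → leaves t ≤ edges t
leaves-≤ (node []) = z≤n
leaves-≤ (node (c ∷ cs)) = leafCountL-≤ (c ∷ cs)

LeafDecorations : Tree → ℕ → Set
LeafDecorations t j = Σ (Decoration t) (λ d → leafCount t + total t d ≡ j)

shift-fiber : (T : D → ℕ) → ∀ {l j} → l ≤ j → Σ D (λ d → T d ≡ j ∸ l) ↔ Σ D (λ d → l + T d ≡ j)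
shift-fiber T {l} {j} l≤j = Σ-↔ ↔-refl (irrelevant-↔ ≡-irrelevant ≡-irrelevant
  (λ eq → trans (cong (l +_) eq) (m+[n∸m]≡n l≤j))
  (λ eq → trans (sym (m+n∸m≡n l (T _))) (cong (_∸ l) eq)))

decorations-with-leafCount : ∀ t {j} → leafCount t ≤ j →
  Fin (((j ∸ leafCount t) + (edges t + edges t)) C (edges t + edges t)) ↔ LeafDecorations t j
decorations-with-leafCount t le = ↔-trans (decorations-with-total t _) (shift-fiber (total t) le)

-- The count C(2e + j - i, 2e) of decorations producing j ≥ 1 leaves, where
-- i = leaves t; it vanishes when t already has more than j leaves.
decorations-with-leaves : ∀ t j → 1 ≤ j →
  Fin ((edges t + edges t + j ∸ leaves t) C (edges t + edges t)) ↔ LeafDecorations t j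
decorations-with-leaves (node []) j 1≤j = decorations-with-leafCount (node []) 1≤j
decorations-with-leaves t@(node cs@(_ ∷ _)) j _ with leafCountL cs ≤? j
... | yes i≤j = ↔-trans (Fin-cong (cong (_C E) index)) (decorations-with-leafCount t i≤j)
  where
  E = edgesL cs + edgesL cs
  index : E + j ∸ leafCountL cs ≡ (j ∸ leafCountL cs) + E
  index = trans (+-∸-assoc E i≤j) (+-comm E (j ∸ leafCountL cs))
... | no i≰j = ↔-trans (Fin-cong (k>n⇒nCk≡0 too-small)) (Fin0↔ too-many)
  where
  E = edgesL cs + edgesL cs
  i = leafCountL cs
  i≤E+j : i ≤ E + j
  i≤E+j = ≤-trans (leafCountL-≤ cs) (≤-trans (m≤m+n (edgesL cs) (edgesL cs)) (m≤m+n E j))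
  too-small : E + j ∸ i < E
  too-small = subst (E + j ∸ i <_) (m+n∸n≡m E i) (∸-monoˡ-< (+-monoʳ-< E (≰⇒> i≰j)) i≤E+j)
  too-many : ¬ LeafDecorations t j
  too-many (d , eq) = i≰j (subst (i ≤_) eq (m≤m+n i (total t d)))

TreeShape : ℕ → ℕ → ℕ → Tree → Set
TreeShape n j k t = edges t ≡ n × leaves t ≡ j × height t ≤ k

PrunedShape : ℕ → ℕ → ℕ → Decorated → Set
PrunedShape e j h (t , d) = edges t ≡ e × leafCount t + total t d ≡ j × height t ≤ h

shape-irrelevant : ∀ {a b c d x y : ℕ} → Irrelevant (a ≡ b × c ≡ d × x ≤ y)
shape-irrelevant (p , q , r) (p′ , q′ , r′) = cong₂ _,_ (≡-irrelevant p p′) (cong₂ _,_ (≡-irrelevant q q′) (≤-irrelevant r r′))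

nonempty-root : ∀ n j k → Trees n (suc j) k ↔ Σ Forest⁺ (TreeShape n (suc j) k ∘ plant)
nonempty-root n j k = mk↔ₛ′ split plant′ (λ _ → refl) plant-split
  where
  split : Trees n (suc j) k → Σ Forest⁺ (TreeShape n (suc j) k ∘ plant)
  split (node (a ∷ as) , p) = (a , as) , p
  plant′ : Σ Forest⁺ (TreeShape n (suc j) k ∘ plant) → Trees n (suc j) k
  plant′ (f , p) = plant f , p
  plant-split : ∀ x → plant′ (split x) ≡ x
  plant-split (node (a ∷ as) , p) = refl

grown-shape : ∀ e j h t d → PrunedShape e j h (t , d) ↔ TreeShape (e + j) j (suc h) (plant (graft t d))
grown-shape e j h t d = irrelevant-↔ shape-irrelevant shape-irrelevant grow shrink
  where
  edges-split : edgesL (toList (graft t d)) ≡ edges t + (leafCount t + total t d)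
  edges-split = trans (edges-graft t d) (+-assoc (edges t) (leafCount t) (total t d))
  grow : PrunedShape e j h (t , d) → TreeShape (e + j) j (suc h) (plant (graft t d))
  grow (pe , pl , ph) = trans edges-split (cong₂ _+_ pe pl)
                      , trans (leaves-graft t d) pl
                      , s≤s (subst (_≤ h) (sym (height-graft t d)) ph)
  shrink : TreeShape (e + j) j (suc h) (plant (graft t d)) → PrunedShape e j h (t , d)
  shrink (pe , pl , ph) = +-cancelʳ-≡ j (edges t) e (trans (cong (edges t +_) (sym leaves-eq)) (trans (sym edges-split) pe))
                        , leaves-eq
                        , subst (_≤ h) (height-graft t d) (s≤s⁻¹ ph)
    where
    leaves-eq : leafCount t + total t d ≡ j
    leaves-eq = trans (sym (leaves-graft t d)) pl

Pruned : ℕ → ℕ → Set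
Pruned e h = Σ Tree (λ t → edges t ≡ e × height t ≤ h)

growths : ℕ → ℕ → ℕ → ℕ
growths e j i = (e + e + j ∸ i) C (e + e)

pruning-count : ∀ e j h → Trees (e + suc j) (suc j) (suc h) ↔ Σ (Fin (suc e)) (λ i → Trees e (toℕ i) h × Fin (growths e (suc j) (toℕ i)))
pruning-count e j h = begin
  Trees (e + suc j) (suc j) (suc h)                                  ↔⟨ nonempty-root (e + suc j) j (suc h) ⟩
  Σ Forest⁺ (TreeShape (e + suc j) (suc j) (suc h) ∘ plant)          ↔⟨ Σ-↔ (↔-sym pruning) (grown-shape e (suc j) h _ _) ⟨
  Σ Decorated (PrunedShape e (suc j) h)                              ↔⟨ regroup ⟩
  Σ (Pruned e h) (λ s → LeafDecorations (proj₁ s) (suc j))           ↔⟨ partition (leaves ∘ proj₁) bound ⟩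
  Σ (Fin (suc e)) (λ i → Σ (Σ (Pruned e h) (λ s → leaves (proj₁ s) ≡ toℕ i)) (λ s → LeafDecorations (proj₁ (proj₁ s)) (suc j)))
                                                                      ↔⟨ Σ-↔ ↔-refl (λ {i} → Σ-↔ reshape (λ {s} → count (toℕ i) s)) ⟩
  Σ (Fin (suc e)) (λ i → Trees e (toℕ i) h × Fin (growths e (suc j) (toℕ i))) ∎
  where
  open ↔-Reasoning
  regroup : Σ Decorated (PrunedShape e (suc j) h) ↔ Σ (Pruned e h) (λ s → LeafDecorations (proj₁ s) (suc j))
  regroup = mk↔ₛ′ (λ ((t , d) , pe , pl , ph) → (t , pe , ph) , d , pl) (λ ((t , pe , ph) , d , pl) → (t , d) , pe , pl , ph)
                  (λ _ → refl) (λ _ → refl)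
  bound : ∀ s → leaves (proj₁ s) ≤ e
  bound (t , pe , _) = subst (leaves t ≤_) pe (leaves-≤ t)
  reshape : ∀ {i} → Σ (Pruned e h) (λ s → leaves (proj₁ s) ≡ i) ↔ Trees e i h
  reshape = mk↔ₛ′ (λ ((t , pe , ph) , pl) → t , pe , pl , ph) (λ (t , pe , pl , ph) → (t , pe , ph) , pl)
                  (λ _ → refl) (λ _ → refl)
  count : ∀ i (s : Σ (Pruned e h) (λ s → leaves (proj₁ s) ≡ i)) → LeafDecorations (proj₁ (proj₁ s)) (suc j) ↔ Fin (growths e (suc j) i)
  count _ ((t , refl , _) , refl) = ↔-sym (decorations-with-leaves t (suc j) (s≤s z≤n))

recurrence : (N : ℕ → ℕ → ℕ → ℕ) → (∀ n j k → HasCard (Trees n j k) (N n j k)) →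
  ∀ e j h → N (e + suc j) (suc j) (suc h) ≡ sumTo e (λ i → N e i h * growths e (suc j) i)
recurrence N card e j h = sym (↔⇒≡ (begin
  Fin (sumTo e (λ i → N e i h * growths e (suc j) i))                              ↔⟨ Fin-sumTo e _ ⟩
  Σ (Fin (suc e)) (λ i → Fin (N e (toℕ i) h * growths e (suc j) (toℕ i)))        ↔⟨ Σ-↔ ↔-refl (↔-trans *↔× (card e _ h ×-↔ ↔-refl)) ⟩
  Σ (Fin (suc e)) (λ i → Trees e (toℕ i) h × Fin (growths e (suc j) (toℕ i)))     ↔⟨ pruning-count e j h ⟨
  Trees (e + suc j) (suc j) (suc h)                                                ↔⟨ card _ _ _ ⟨
  Fin (N (e + suc j) (suc j) (suc h))                                              ∎))
  where open ↔-Reasoning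

-- Index arithmetic translating between n, j and e = n - j; the last one is
-- what reversing the summation does to the binomial coefficient.
top-index : ∀ e j → 2 * (e + j) ∸ j ≡ e + e + j
top-index e j = trans (cong (_∸ j) (double e j)) (m+n∸n≡m (e + e + j) j)
  where
  double : ∀ e j → 2 * (e + j) ≡ e + e + j + j
  double = solve-∀

bottom-index : ∀ e j → 2 * (e + j) ∸ 2 * j ≡ e + e
bottom-index e j = trans (cong (_∸ 2 * j) (double e j)) (m+n∸n≡m (e + e) (2 * j))
  where
  double : ∀ e j → 2 * (e + j) ≡ e + e + 2 * j
  double = solve-∀

reflected-index : ∀ e j i → i ≤ e → e + e + j ∸ (e ∸ i) ≡ e + j + i
reflected-index e j i i≤e = begin
  e + e + j ∸ (e ∸ i)                   ≡⟨ cong (λ x → x + e + j ∸ (e ∸ i)) (sym (m∸n+n≡m i≤e)) ⟩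
  (e ∸ i) + i + e + j ∸ (e ∸ i)         ≡⟨ cong (_∸ (e ∸ i)) (regroup (e ∸ i) i e j) ⟩
  (e ∸ i) + (e + j + i) ∸ (e ∸ i)       ≡⟨ m+n∸m≡n (e ∸ i) (e + j + i) ⟩
  e + j + i                             ∎
  where
  open ≡-Reasoning
  regroup : ∀ a i e j → a + i + e + j ≡ a + (e + j + i)
  regroup = solve-∀

theorem16 : (N : ℕ → ℕ → ℕ → ℕ) → (∀ n j k → HasCard (Trees n j k) (N n j k)) →
            ∀ n j k → 1 ≤ k → 1 ≤ j → j ≤ n →
              (N n j k ≡ sumTo (n ∸ j) (λ i → N (n ∸ j) i (k ∸ 1) * ((2 * n ∸ j ∸ i) C (2 * n ∸ 2 * j))))
              × (N n j k ≡ sumTo (n ∸ j) (λ i → N (n ∸ j) (n ∸ j ∸ i) (k ∸ 1) * ((n + i) C (2 * n ∸ 2 * j))))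
theorem16 N card n (suc j) (suc h) (s≤s z≤n) (s≤s z≤n) j≤n with n ∸ suc j | m∸n+n≡m j≤n
... | e | refl rewrite top-index e (suc j) | bottom-index e (suc j) = forward , backward
  where
  forward : N (e + suc j) (suc j) (suc h) ≡ sumTo e (λ i → N e i h * growths e (suc j) i)
  forward = recurrence N card e j h
  backward : N (e + suc j) (suc j) (suc h) ≡ sumTo e (λ i → N e (e ∸ i) h * ((e + suc j + i) C (e + e)))
  backward = trans forward (trans (sumTo-reverse e _) (sumTo-cong e _ _ λ i i≤e →
    cong (λ top → N e (e ∸ i) h * (top C (e + e))) (reflected-index e (suc j) i i≤e)))
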